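{- Let $q\ge2$ be even, let $\mathbf f\in A_q^+\setminus U_q$ have last symbol $0$, let $\ell\ge1$ be the length of the maximal suffix of $\mathbf f$ consisting only of $0$s, and let $\mathbf p\in A_q^*(\mathbf f)$. If $\mathbf a$ is the $\prec$-first or the $\prec$-last word of $\mathbf p|A_q^\infty(\mathbf f)$, then $\mathbf a=\mathbf p\mathbf r0^\infty$, where: (1) if $\mathbf a$ is the $\prec$-first word and $\mathbf p$ has even parity, or $\mathbf a$ is the $\prec$-last word and $\mathbf p$ has odd parity, then $\mathbf r=\epsilon$ or $\mathbf r=0^i1(q-1)$ for some $0\le i\le\ell-1$; (2) if $\mathbf a$ is the $\prec$-first word and $\mathbf p$ has odd parity, or $\mathbf a$ is the $\prec$-last word and $\mathbf p$ has even parity, then $\mathbf r=(q-1)$ or $\mathbf r=(q-1)0^{\ell-1}1(q-1)$.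
   Context: $A_q=\{0,1,\dots,q-1\}$. $A_q^*$ (resp. $A_q^+$) is the set of all (resp. nonempty) finite words, $\epsilon$ the empty word, $A_q^\infty$ the right-infinite words; $\mathbf a^i$ is $i$-fold concatenation, $\mathbf a^\infty=\mathbf a\mathbf a\cdots$, $\mathbf a^{ -\infty}=\cdots\mathbf a\mathbf a$ (left-infinite), and a suffix of a left-infinite word is a finite (possibly empty) word with which it ends. For a set $X$ of words, $X(\mathbf f)$ is the set of words of $X$ not containing $\mathbf f$ as a factor (contiguous subword), $\mathbf p|X$ the words of $X$ with prefix $\mathbf p$. For distinct words $\mathbf s,\mathbf t$ of the same (finite or infinite) length, with $k$ the leftmost differing position and $u=\sum_{i<k}s_i$, $\mathbf s\prec\mathbf t$ iff ($u$ even and $s_k<t_k$) or ($u$ odd and $s_k>t_k$); $\prec$-first/last mean least/greatest. For even $q$, the parity of a word $a_1\cdots a_n$ is the parity of $\sum_i a_i$. $U_q=\bigcup_{m\ge0}\{\mathbf b0:\mathbf b\text{ a suffix of }(1(q-1)0^m)^{ -\infty}\}$. -}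

module Defs where

open import Data.Nat using (ℕ; zero; suc; _+_; _∸_; _<_; _%_)
open import Data.Fin using (Fin; toℕ)
open import Data.List using (List; []; _∷_; _++_; length; lookup; replicate; concat; reverse)
open import Data.Nat.ListAction using (sum)
open import Data.List.Relation.Unary.All using (All)
open import Data.Product using (Σ; ∃; _×_; _,_)
open import Data.Sum using (_⊎_)
open import Relation.Binary.PropositionalEquality using (_≡_)
open import Relation.Nullary using (¬_)

Word : Set
Word = List ℕ

IsWord : ℕ → Word → Set
IsWord q w = All (_< q) w

InfWord : Set
InfWord = ℕ → ℕ

IsInfWord : ℕ → InfWord → Set
IsInfWord q a = ∀ i → a i < q

_≐_ : InfWord → InfWord → Set
a ≐ b = ∀ i → a i ≡ b i

Even : ℕ → Set
Even n = n % 2 ≡ 0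

Odd : ℕ → Set
Odd n = n % 2 ≡ 1

EvenWord : Word → Set
EvenWord w = Even (sum w)

OddWord : Word → Set
OddWord w = Odd (sum w)

FactorOf : Word → Word → Set
FactorOf f w = ∃ λ u → ∃ λ v → w ≡ u ++ f ++ v

InfFactorOf : Word → InfWord → Set
InfFactorOf f a = ∃ λ n → ∀ (i : Fin (length f)) → a (n + toℕ i) ≡ lookup f i

PrefixOf : Word → InfWord → Set
PrefixOf p a = ∀ (i : Fin (length p)) → a (toℕ i) ≡ lookup p i

_⊕_ : Word → InfWord → InfWord
([]     ⊕ a) n       = a n
((x ∷ w) ⊕ a) zero    = x
((x ∷ w) ⊕ a) (suc n) = (w ⊕ a) n

zeros : InfWord
zeros _ = 0

sumTo : InfWord → ℕ → ℕ
sumTo a zero    = 0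
sumTo a (suc k) = sumTo a k + a k

_≺_ : InfWord → InfWord → Set
s ≺ t = ∃ λ k → (∀ i → i < k → s i ≡ t i)
          × ((Even (sumTo s k) × s k < t k) ⊎ (Odd (sumTo s k) × t k < s k))

_≼_ : InfWord → InfWord → Set
s ≼ t = s ≺ t ⊎ s ≐ t

InCyl : ℕ → Word → Word → InfWord → Set
InCyl q f p a = IsInfWord q a × PrefixOf p a × ¬ InfFactorOf f a

IsFirst : ℕ → Word → Word → InfWord → Set
IsFirst q f p a = InCyl q f p a × (∀ b → InCyl q f p b → a ≼ b)

IsLast : ℕ → Word → Word → InfWord → Set
IsLast q f p a = InCyl q f p a × (∀ b → InCyl q f p b → b ≼ a)

block : ℕ → ℕ → Word
block q m = 1 ∷ (q ∸ 1) ∷ replicate m 0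

-- b is a suffix of the left-infinite word (1(q-1)0^m)^{-∞}
-- iff b is a suffix of (1(q-1)0^m)^k for some k.
SuffixOfLeftInf : ℕ → ℕ → Word → Set
SuffixOfLeftInf q m b = ∃ λ k → ∃ λ c → c ++ b ≡ concat (replicate k (block q m))

InU : ℕ → Word → Set
InU q f = ∃ λ m → ∃ λ b → SuffixOfLeftInf q m b × f ≡ b ++ 0 ∷ []

leadingZeros : Word → ℕ
leadingZeros []            = 0
leadingZeros (zero ∷ w)    = suc (leadingZeros w)
leadingZeros (suc _ ∷ w)   = 0

trailingZeros : Word → ℕ
trailingZeros w = leadingZeros (reverse w)

Shape1 : ℕ → ℕ → Word → Set
Shape1 q ℓ r = r ≡ [] ⊎ (∃ λ i → i < ℓ × r ≡ replicate i 0 ++ 1 ∷ (q ∸ 1) ∷ [])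

Shape2 : ℕ → ℕ → Word → Set
Shape2 q ℓ r = r ≡ (q ∸ 1) ∷ [] ⊎ r ≡ (q ∸ 1) ∷ replicate (ℓ ∸ 1) 0 ++ 1 ∷ (q ∸ 1) ∷ []

module Submission where

-- For a word P avoiding f we build a "greedy" continuation P r 0^∞:
-- r = ε if P 0^∞ avoids f; otherwise, with i least such that f occurs in
-- P 0^(i+1), r = 0^i 1 (q-1).  This continuation avoids f precisely because
-- f ∉ U_q (an occurrence would make f a suffix of a power of a block
-- 1 (q-1) 0^t), and it forces i < ℓ, with i = ℓ-1 when P ends in a nonzero
-- symbol.  At every position past P, the greedy word picks a symbol that is
-- extremal in the local order at that position (0, q-1, or 1 where 0 is
-- forbidden); for the right parity S this makes it ≺-least, for the other
-- ≺-greatest, so every first/last word of the cylinder coincides with it.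
-- Case (2) first appends q-1 to p (the extremal symbol there) and applies the
-- greedy construction to p(q-1), which ends in a nonzero symbol.

open import Defs
open import Data.Nat using (ℕ; _≤_)
open import Data.List using (List; []; _∷_; _++_)
open import Data.Product using (Σ; ∃; _×_; _,_)
open import Relation.Binary.PropositionalEquality using (_≡_)
open import Relation.Nullary using (¬_)

open import Data.Nat using (zero; suc; _+_; _∸_; _<_; z≤n; s≤s; _%_)
open import Data.Nat.Properties
open import Data.Nat.DivMod using (%-distribˡ-+; m%n%n≡m%n; m%n<n)
open import Data.Fin using (toℕ; fromℕ<) renaming (zero to fzero; suc to fsuc)
open import Data.Fin.Properties using (toℕ<n; toℕ-fromℕ<)
open import Data.List using (length; replicate; concat; reverse)
open import Data.List.Properties
  using (++-assoc; ++-identityʳ; length-++; length-replicate; reverse-++; reverse-involutive; ∷ʳ-injective; ∷-injective; unfold-reverse)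
open import Data.Nat.ListAction using (sum)
open import Data.Nat.ListAction.Properties using (sum-++)
open import Data.List.Relation.Unary.All using ([]; _∷_)
open import Data.Product using (proj₁; proj₂)
open import Data.Sum using (_⊎_; inj₁; inj₂)
open import Data.Empty using (⊥; ⊥-elim)
open import Relation.Binary.PropositionalEquality using (refl; sym; trans; cong; cong₂; subst; _≢_; module ≡-Reasoning)
open import Relation.Nullary using (Dec; yes; no)

-- Parity

SameParity : ℕ → ℕ → Set
SameParity m n = m % 2 ≡ n % 2

parity-+ : ∀ m n → (m + n) % 2 ≡ (m % 2 + n % 2) % 2
parity-+ m n = %-distribˡ-+ m n 2

even-or-odd : ∀ n → Even n ⊎ Odd n
even-or-odd n with n % 2 | m%n<n n 2
... | zero        | _ = inj₁ refl
... | suc zero    | _ = inj₂ refl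
... | suc (suc _) | s≤s (s≤s ())

even⇒¬odd : ∀ {n} → Even n → ¬ Odd n
even⇒¬odd e o with trans (sym e) o
... | ()

even+odd : ∀ {m n} → Even m → Odd n → Odd (m + n)
even+odd {m} {n} em on = trans (parity-+ m n) (cong₂ (λ x y → (x + y) % 2) em on)

odd+odd : ∀ {m n} → Odd m → Odd n → Even (m + n)
odd+odd {m} {n} om on = trans (parity-+ m n) (cong₂ (λ x y → (x + y) % 2) om on)

+-even : ∀ s {t} → Even t → SameParity (s + t) s
+-even s {t} et = trans (parity-+ s t) (trans (cong (λ z → (s % 2 + z) % 2) et)
  (trans (cong (_% 2) (+-identityʳ (s % 2))) (m%n%n≡m%n s 2)))

odd-pred : ∀ {n} → Even (suc n) → Odd n
odd-pred {n} e with even-or-odd n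
... | inj₂ o  = o
... | inj₁ en = ⊥-elim (even⇒¬odd {suc n} e (subst Odd (+-comm n 1) (even+odd {n} {1} en refl)))

-- Finite words

++-split : (a b c d : Word) → a ++ b ≡ c ++ d →
  (∃ λ s → a ≡ c ++ s × d ≡ s ++ b) ⊎ (∃ λ s → c ≡ a ++ s × b ≡ s ++ d)
++-split []      b c       d eq = inj₂ (c , refl , eq)
++-split (x ∷ a) b []      d eq = inj₁ (x ∷ a , refl , sym eq)
++-split (x ∷ a) b (y ∷ c) d eq with ∷-injective eq
... | refl , eq′ with ++-split a b c d eq′
... | inj₁ (s , e₁ , e₂) = inj₁ (s , cong (x ∷_) e₁ , e₂)
... | inj₂ (s , e₁ , e₂) = inj₂ (s , cong (x ∷_) e₁ , e₂)

prefix? : (f w : Word) → Dec (∃ λ v → w ≡ f ++ v)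
prefix? []      w       = yes (w , refl)
prefix? (y ∷ f) []      = no λ { (v , ()) }
prefix? (y ∷ f) (x ∷ w) with x ≟ y | prefix? f w
... | yes refl | yes (v , e) = yes (v , cong (x ∷_) e)
... | yes refl | no ¬p       = no λ { (v , e) → ¬p (v , proj₂ (∷-injective e)) }
... | no x≢y   | _           = no λ { (v , e) → x≢y (proj₁ (∷-injective e)) }

factor? : (f w : Word) → Dec (FactorOf f w)
factor? f [] with prefix? f []
... | yes (v , e) = yes ([] , v , e)
... | no ¬p       = no λ { ([] , v , e) → ¬p (v , e) ; (_ ∷ _ , _ , ()) }
factor? f (x ∷ w) with prefix? f (x ∷ w) | factor? f w
... | yes (v , e) | _               = yes ([] , v , e)
... | no _        | yes (u , v , e) = yes (x ∷ u , v , cong (x ∷_) e)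
... | no ¬p       | no ¬q           =
  no λ { ([] , v , e) → ¬p (v , e) ; (_ ∷ u , v , e) → ¬q (u , v , proj₂ (∷-injective e)) }

first-zero-occurrence : (f P : Word) (N : ℕ) → FactorOf f (P ++ replicate N 0) → ¬ FactorOf f P →
  ∃ λ i → FactorOf f (P ++ replicate (suc i) 0) × ¬ FactorOf f (P ++ replicate i 0)
first-zero-occurrence f P zero    occ ¬occ = ⊥-elim (¬occ (subst (FactorOf f) (++-identityʳ P) occ))
first-zero-occurrence f P (suc N) occ ¬occ with factor? f (P ++ replicate N 0)
... | yes occ′ = first-zero-occurrence f P N occ′ ¬occ
... | no ¬occ′ = N , occ , ¬occ′

new-occurrence-is-suffix : (f Q : Word) (x : ℕ) → ¬ FactorOf f Q → FactorOf f (Q ++ x ∷ []) →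
  ∃ λ u → u ++ f ≡ Q ++ x ∷ []
new-occurrence-is-suffix f Q x ¬occ (u , v , e) =
  cases (++-split (u ++ f) v Q (x ∷ []) (trans (++-assoc u f v) (sym e)))
  where
  cases : (∃ λ s → u ++ f ≡ Q ++ s × x ∷ [] ≡ s ++ v) ⊎ (∃ λ s → Q ≡ (u ++ f) ++ s × v ≡ s ++ x ∷ []) →
          ∃ λ u → u ++ f ≡ Q ++ x ∷ []
  cases (inj₁ ([] , e₁ , _)) = ⊥-elim (¬occ (u , [] ,
    trans (sym (++-identityʳ Q)) (trans (sym e₁) (trans (sym (++-identityʳ (u ++ f))) (++-assoc u f [])))))
  cases (inj₁ (y ∷ [] , e₁ , e₂)) with ∷-injective e₂
  ... | refl , _ = u , e₁
  cases (inj₁ (_ ∷ _ ∷ _ , _ , ()))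
  cases (inj₂ (s , e₁ , _)) = ⊥-elim (¬occ (u , s , trans e₁ (++-assoc u f s)))

replicate-snoc : (n x : ℕ) → replicate (suc n) x ≡ replicate n x ++ x ∷ []
replicate-snoc zero    x = refl
replicate-snoc (suc n) x = cong (x ∷_) (replicate-snoc n x)

reverse-replicate : (n x : ℕ) → reverse (replicate n x) ≡ replicate n x
reverse-replicate zero    x = refl
reverse-replicate (suc n) x = trans (unfold-reverse x (replicate n x))
  (trans (cong (_++ x ∷ []) (reverse-replicate n x)) (sym (replicate-snoc n x)))

prefix-of-zeros : (w v : Word) (M : ℕ) → w ++ v ≡ replicate M 0 → w ≡ replicate (length w) 0
prefix-of-zeros []      v M       e = refl
prefix-of-zeros (y ∷ w) v (suc M) e with ∷-injective e
... | refl , e′ = cong (0 ∷_) (prefix-of-zeros w v M e′)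

power-snoc : (B : Word) (k : ℕ) → concat (replicate k B) ++ B ≡ concat (replicate (suc k) B)
power-snoc B zero    = sym (++-identityʳ B)
power-snoc B (suc k) = trans (++-assoc B _ B) (cong (B ++_) (power-snoc B k))

++-longer : (s B : Word) → 0 < length B → length s < length (s ++ B)
++-longer s B B>0 = subst (length s <_) (sym (length-++ s)) (m<m+n (length s) B>0)

-- A word s with s B = y s (B nonempty) is a suffix of a power of B; by
-- induction on a bound n for |s|, peeling one copy of B off the right of s.
periodic-suffix : (B : Word) → 0 < length B → ∀ n s y → length s ≤ n → s ++ B ≡ y ++ s →
  ∃ λ k → ∃ λ u → u ++ s ≡ concat (replicate k B)
periodic-suffix B B>0 n s y le eq with ++-split s B y s eq
... | inj₂ (s₂ , _ , e) = 1 , s₂ , trans (sym e) (sym (++-identityʳ B))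
periodic-suffix B B>0 zero s y le eq | inj₁ (s₁ , _ , s≡) =
  ⊥-elim (n≮0 (<-≤-trans (++-longer s₁ B B>0) (subst (λ z → length z ≤ 0) s≡ le)))
periodic-suffix B B>0 (suc n) s y le eq | inj₁ (s₁ , e₁ , s≡)
  with periodic-suffix B B>0 n s₁ y
         (≤-pred (≤-trans (++-longer s₁ B B>0) (subst (λ z → length z ≤ suc n) s≡ le))) (trans (sym s≡) e₁)
... | k , u , e = suc k , u ,
  trans (cong (u ++_) s≡) (trans (sym (++-assoc u s₁ B)) (trans (cong (_++ B) e) (power-snoc B k)))

border⇒power-suffix : (B : Word) → 0 < length B → (x u s : Word) → x ++ (s ++ B) ≡ u ++ s →
  ∃ λ k → ∃ λ u′ → u′ ++ (s ++ B) ≡ concat (replicate k B)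
border⇒power-suffix B B>0 x u s e with ++-split x (s ++ B) u s e
... | inj₁ (s₀ , _ , s≡) = ⊥-elim (<-irrefl (cong length s≡) (<-≤-trans (++-longer s B B>0)
        (≤-trans (m≤n+m _ (length s₀)) (≤-reflexive (sym (length-++ s₀))))))
... | inj₂ (y , _ , period) with periodic-suffix B B>0 (length s) s y ≤-refl period
... | k , u′ , e′ = suc k , u′ , trans (sym (++-assoc u′ s B)) (trans (cong (_++ B) e′) (power-snoc B k))

leading-zeros-decomposition : (w : Word) → w ≡ replicate (leadingZeros w) 0 ⊎
  (∃ λ y → ∃ λ s → (y ≢ 0) × w ≡ replicate (leadingZeros w) 0 ++ y ∷ s)
leading-zeros-decomposition []          = inj₁ refl
leading-zeros-decomposition (zero ∷ w) with leading-zeros-decomposition w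
... | inj₁ e               = inj₁ (cong (0 ∷_) e)
... | inj₂ (y , s , y≢0 , e) = inj₂ (y , s , y≢0 , cong (0 ∷_) e)
leading-zeros-decomposition (suc y ∷ w) = inj₂ (suc y , w , (λ ()) , refl)

leading-zeros-bound : (a b y : ℕ) (s t : Word) → y ≢ 0 → replicate a 0 ++ y ∷ s ≡ replicate b 0 ++ t → b ≤ a
leading-zeros-bound a       zero    y s t y≢0 e = z≤n
leading-zeros-bound zero    (suc b) y s t y≢0 e = ⊥-elim (y≢0 (proj₁ (∷-injective e)))
leading-zeros-bound (suc a) (suc b) y s t y≢0 e = s≤s (leading-zeros-bound a b y s t y≢0 (proj₂ (∷-injective e)))

⊕-shift : (w : Word) (Y : InfWord) (m : ℕ) → (w ⊕ Y) (length w + m) ≡ Y m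
⊕-shift []      Y m = refl
⊕-shift (x ∷ w) Y m = ⊕-shift w Y m

⊕-++ : (u v : Word) (Y : InfWord) → ((u ++ v) ⊕ Y) ≐ (u ⊕ (v ⊕ Y))
⊕-++ []      v Y n       = refl
⊕-++ (x ∷ u) v Y zero    = refl
⊕-++ (x ∷ u) v Y (suc n) = ⊕-++ u v Y n

⊕-cong : (w : Word) {X X′ : InfWord} → X ≐ X′ → (w ⊕ X) ≐ (w ⊕ X′)
⊕-cong []      e n       = e n
⊕-cong (x ∷ w) e zero    = refl
⊕-cong (x ∷ w) e (suc n) = ⊕-cong w e n

⊕-word : (q : ℕ) (w : Word) (Y : InfWord) → IsWord q w → IsInfWord q Y → IsInfWord q (w ⊕ Y)
⊕-word q []      Y []         hY n       = hY n
⊕-word q (x ∷ w) Y (hx ∷ hw) hY zero    = hx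
⊕-word q (x ∷ w) Y (hx ∷ hw) hY (suc n) = ⊕-word q w Y hw hY n

word-snoc : (q : ℕ) (w : Word) (x : ℕ) → IsWord q w → x < q → IsWord q (w ++ x ∷ [])
word-snoc q []      x []         h = h ∷ []
word-snoc q (y ∷ w) x (hy ∷ hw) h = hy ∷ word-snoc q w x hw h

prefix-⊕ : (w : Word) (Y : InfWord) → PrefixOf w (w ⊕ Y)
prefix-⊕ []      Y ()
prefix-⊕ (x ∷ w) Y fzero    = refl
prefix-⊕ (x ∷ w) Y (fsuc i) = prefix-⊕ w Y i

prefix-≐ : {p : Word} {a b : InfWord} → a ≐ b → PrefixOf p a → PrefixOf p b
prefix-≐ e pa i = trans (sym (e (toℕ i))) (pa i)

occurrence-≐ : {f : Word} {a b : InfWord} → a ≐ b → InfFactorOf f a → InfFactorOf f b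
occurrence-≐ e (n , h) = n , λ i → trans (sym (e (n + toℕ i))) (h i)

prefix-agree : (P : Word) {a W : InfWord} → PrefixOf P W → (∀ t → t < length P → a t ≡ W t) → PrefixOf P a
prefix-agree P pW agree i = trans (agree (toℕ i) (toℕ<n i)) (pW i)

prefix-at : (P : Word) {a b : InfWord} {t : ℕ} → PrefixOf P a → PrefixOf P b → t < length P → a t ≡ b t
prefix-at P {a} {b} pa pb t<P =
  subst (λ z → a z ≡ b z) (toℕ-fromℕ< t<P) (trans (pa (fromℕ< t<P)) (sym (pb (fromℕ< t<P))))

prefix-snoc : (P : Word) {a : InfWord} {x : ℕ} → PrefixOf P a → a (length P) ≡ x → PrefixOf (P ++ x ∷ []) a
prefix-snoc []      pa e fzero    = e
prefix-snoc (y ∷ P) pa e fzero    = pa fzero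
prefix-snoc (y ∷ P) {a} pa e (fsuc i) = prefix-snoc P {λ t → a (suc t)} (λ j → pa (fsuc j)) e i

snoc-at : (P : Word) {a : InfWord} {x : ℕ} → PrefixOf (P ++ x ∷ []) a → a (length P) ≡ x
snoc-at []      pa = pa fzero
snoc-at (y ∷ P) {a} pa = snoc-at P {λ t → a (suc t)} (λ j → pa (fsuc j))

prefix-take : (f : Word) {v : Word} {a : InfWord} → PrefixOf (f ++ v) a → PrefixOf f a
prefix-take []      pa ()
prefix-take (y ∷ f) pa fzero    = pa fzero
prefix-take (y ∷ f) {v} {a} pa (fsuc i) = prefix-take f {v} {λ t → a (suc t)} (λ j → pa (fsuc j)) i

prefix-drop : (u : Word) {w : Word} {a : InfWord} → PrefixOf (u ++ w) a → PrefixOf w (λ t → a (length u + t))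
prefix-drop []      pa = pa
prefix-drop (x ∷ u) {w} {a} pa = prefix-drop u {w} {λ t → a (suc t)} (λ j → pa (fsuc j))

factor⇒occurrence : {f Q : Word} {a : InfWord} → FactorOf f Q → PrefixOf Q a → InfFactorOf f a
factor⇒occurrence {f} {a = a} (u , v , e) pa =
  length u , prefix-take f {v} {λ t → a (length u + t)} (prefix-drop u {f ++ v} {a} (subst (λ Q → PrefixOf Q a) e pa))

zeros-prefix-occurrence : (f v : Word) → PrefixOf f (v ⊕ zeros) → ∃ λ t → v ++ replicate (length f) 0 ≡ f ++ t
zeros-prefix-occurrence []      v h = v ++ [] , refl
zeros-prefix-occurrence (y ∷ f) (x ∷ v) h with h fzero | zeros-prefix-occurrence f v (λ i → h (fsuc i))
... | refl | t , e = t ++ 0 ∷ [] , cong (x ∷_)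
  (trans (cong (v ++_) (replicate-snoc (length f) 0))
  (trans (sym (++-assoc v (replicate (length f) 0) (0 ∷ [])))
  (trans (cong (_++ 0 ∷ []) e) (++-assoc f t (0 ∷ [])))))
zeros-prefix-occurrence (y ∷ f) [] h with h fzero | zeros-prefix-occurrence f [] (λ i → h (fsuc i))
... | refl | t , e = t , cong (0 ∷_) e

zeros-occurrence-at : (f w : Word) (n : ℕ) → PrefixOf f (λ t → (w ⊕ zeros) (n + t)) →
  FactorOf f (w ++ replicate (length f) 0)
zeros-occurrence-at f w zero h with zeros-prefix-occurrence f w h
... | t , e = [] , t , e
zeros-occurrence-at f [] (suc n) h with zeros-prefix-occurrence f [] h
... | t , e = [] , t , e
zeros-occurrence-at f (x ∷ w) (suc n) h with zeros-occurrence-at f w n h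
... | u , v , e = x ∷ u , v , cong (x ∷_) e

zeros-occurrence : (f w : Word) → InfFactorOf f (w ⊕ zeros) → FactorOf f (w ++ replicate (length f) 0)
zeros-occurrence f w (n , h) = zeros-occurrence-at f w n h

-- Prefix sums of infinite words (they decide the parity in ≺)

sumTo-suc : (F : InfWord) (n : ℕ) → sumTo F (suc n) ≡ F 0 + sumTo (λ i → F (suc i)) n
sumTo-suc F zero    = +-comm 0 (F 0)
sumTo-suc F (suc n) = trans (cong (_+ F (suc n)) (sumTo-suc F n)) (+-assoc (F 0) _ _)

sumTo-⊕ : (w : Word) (Y : InfWord) (m : ℕ) → sumTo (w ⊕ Y) (length w + m) ≡ sum w + sumTo Y m
sumTo-⊕ []      Y m = refl
sumTo-⊕ (x ∷ w) Y m = trans (sumTo-suc ((x ∷ w) ⊕ Y) (length w + m))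
  (trans (cong (x +_) (sumTo-⊕ w Y m)) (sym (+-assoc x (sum w) _)))

sumTo-cong : (F G : InfWord) (n : ℕ) → (∀ i → i < n → F i ≡ G i) → sumTo F n ≡ sumTo G n
sumTo-cong F G zero    h = refl
sumTo-cong F G (suc n) h = cong₂ _+_ (sumTo-cong F G n (λ i i<n → h i (m<n⇒m<1+n i<n))) (h n ≤-refl)

sumTo-zeros : (n : ℕ) → sumTo zeros n ≡ 0
sumTo-zeros zero    = refl
sumTo-zeros (suc n) = cong (_+ 0) (sumTo-zeros n)

sumTo-prefix : (p : Word) {a : InfWord} → PrefixOf p a → sumTo a (length p) ≡ sum p
sumTo-prefix []      pa = refl
sumTo-prefix (x ∷ p) {a} pa = trans (sumTo-suc a (length p))
  (cong₂ _+_ (pa fzero) (sumTo-prefix p {λ t → a (suc t)} (λ j → pa (fsuc j))))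

zeros-⊕-low : (i t : ℕ) (Y : InfWord) → t < i → (replicate i 0 ⊕ Y) t ≡ 0
zeros-⊕-low (suc i) zero    Y _         = refl
zeros-⊕-low (suc i) (suc t) Y (s≤s t<i) = zeros-⊕-low i t Y t<i

zeros-⊕-high : (i n : ℕ) (Y : InfWord) → (replicate i 0 ⊕ Y) (i + n) ≡ Y n
zeros-⊕-high zero    n Y = refl
zeros-⊕-high (suc i) n Y = zeros-⊕-high i n Y

sumTo-zeros-⊕-low : (i t : ℕ) (Y : InfWord) → t ≤ i → sumTo (replicate i 0 ⊕ Y) t ≡ 0
sumTo-zeros-⊕-low i t Y t≤i =
  trans (sumTo-cong _ zeros t (λ j j<t → zeros-⊕-low i j Y (<-≤-trans j<t t≤i))) (sumTo-zeros t)

sumTo-zeros-⊕-high : (i n : ℕ) (Y : InfWord) → sumTo (replicate i 0 ⊕ Y) (i + n) ≡ sumTo Y n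
sumTo-zeros-⊕-high zero    n Y = refl
sumTo-zeros-⊕-high (suc i) n Y = trans (sumTo-suc (replicate (suc i) 0 ⊕ Y) (i + n)) (sumTo-zeros-⊕-high i n Y)

-- The local order deciding ≺

-- At a position whose prefix sum is e, the symbol x comes before y; a ≺ b
-- holds iff this is the case at the first position where a and b differ.
Precedes : ℕ → ℕ → ℕ → Set
Precedes e x y = (Even e × x < y) ⊎ (Odd e × y < x)

precedes-irrefl : ∀ {e x y} → x ≡ y → ¬ Precedes e x y
precedes-irrefl refl (inj₁ (_ , x<x)) = <-irrefl refl x<x
precedes-irrefl refl (inj₂ (_ , x<x)) = <-irrefl refl x<x

Agree : InfWord → InfWord → ℕ → Set
Agree a W k = ∀ t → t < k → a t ≡ W t

sum-snoc : (p : Word) (x : ℕ) → sum (p ++ x ∷ []) ≡ sum p + x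
sum-snoc p x = trans (sum-++ p (x ∷ [])) (cong (sum p +_) (+-identityʳ x))

length-snoc-+ : (p : Word) (x m : ℕ) → length (p ++ x ∷ []) + m ≡ length p + suc m
length-snoc-+ p x m = trans (cong (_+ m) (length-++ p)) (+-assoc (length p) 1 m)

-- The greedy continuation, for fixed q and f = g0 ∉ U_q

module GreedyContinuation (q : ℕ) (q-even : Even q) (2≤q : 2 ≤ q)
                          (f g : Word) (f≡g0 : f ≡ g ++ 0 ∷ []) (f∉U : ¬ InU q f) where

  c : ℕ
  c = q ∸ 1

  suc-c : suc c ≡ q
  suc-c = m+[n∸m]≡n {1} {q} (≤-trans (s≤s z≤n) 2≤q)

  c≢0 : c ≢ 0
  c≢0 c≡0 = 1+n≰n (subst (2 ≤_) (trans (sym suc-c) (cong suc c≡0)) 2≤q)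

  c<q : c < q
  c<q = subst (c <_) suc-c ≤-refl

  0<q : 0 < q
  0<q = ≤-trans (s≤s z≤n) 2≤q

  c-maximal : ∀ {x} → c < x → x < q → ⊥
  c-maximal {x} c<x x<q = <-irrefl refl (<-≤-trans c<x (≤-pred (subst (x <_) (sym suc-c) x<q)))

  odd-c : Odd c
  odd-c = odd-pred {c} (subst Even (sym suc-c) q-even)

  ℓ : ℕ
  ℓ = trailingZeros f

  power-suffix⇒U : (t k : ℕ) (u : Word) → u ++ g ≡ concat (replicate k (block q t)) → InU q f
  power-suffix⇒U t k u e = t , g , (k , u , e) , f≡g0

  block-prefix : (w v : Word) (M : ℕ) → w ++ 0 ∷ v ≡ 1 ∷ c ∷ replicate M 0 → ∃ λ t → w ≡ block q t
  block-prefix []           v M ()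
  block-prefix (y ∷ [])     v M e = ⊥-elim (c≢0 (sym (proj₁ (∷-injective (proj₂ (∷-injective e))))))
  block-prefix (y ∷ y′ ∷ w) v M e with ∷-injective e
  ... | refl , e′ with ∷-injective e′
  ... | refl , e″ = length w , cong (λ z → 1 ∷ c ∷ z) (prefix-of-zeros w (0 ∷ v) M e″)

  -- f occurs inside the appended 1 (q-1) 0^M: then g is a suffix of a block.
  inside-block⇒U : (s v : Word) (M : ℕ) → 1 ∷ c ∷ replicate M 0 ≡ s ++ f ++ v → InU q f
  inside-block⇒U s v M e with block-prefix (s ++ g) v M (sym (trans e (trans (cong (λ z → s ++ z ++ v) f≡g0)
                                 (trans (cong (s ++_) (++-assoc g (0 ∷ []) v)) (sym (++-assoc s g (0 ∷ v)))))))
  ... | t , sg≡B = power-suffix⇒U t 1 s (trans sg≡B (sym (++-identityʳ (block q t))))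

  -- f = s z s′ straddles the end of Q = u s = x g: then g = s B for a block B,
  -- and s, s B both being suffixes of Q makes g a suffix of a power of B.
  straddle⇒U : (x u s : Word) (z : ℕ) (s′ v : Word) (M : ℕ) → x ++ g ≡ u ++ s → f ≡ s ++ z ∷ s′ →
    1 ∷ c ∷ replicate M 0 ≡ (z ∷ s′) ++ v → InU q f
  straddle⇒U x u s z s′ v M xg≡us f≡ blk with ++-split g (0 ∷ []) s (z ∷ s′) (trans (sym f≡g0) f≡)
  ... | inj₂ ([] , _ , e₀) = ⊥-elim (1+n≢0 (trans (proj₁ (∷-injective blk)) (sym (proj₁ (∷-injective e₀)))))
  ... | inj₂ (_ ∷ [] , _ , ())
  ... | inj₂ (_ ∷ _ ∷ _ , _ , ())
  ... | inj₁ (w , g≡sw , zs′≡w0)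
    with block-prefix w v M (sym (trans blk (trans (cong (_++ v) zs′≡w0) (++-assoc w (0 ∷ []) v))))
  ... | t , w≡B with border⇒power-suffix (block q t) (s≤s z≤n) x u s
                       (trans (cong (x ++_) (sym (trans g≡sw (cong (s ++_) w≡B)))) xg≡us)
  ... | k , u′ , e = power-suffix⇒U t k u′ (trans (cong (u′ ++_) (trans g≡sw (cong (s ++_) w≡B))) e)

  -- The key avoidance fact: if g is a suffix of Q and f ∉ Q, then f does not
  -- occur in Q 1 (q-1) 0^M, since any occurrence would put f into U_q.
  block-extension⇒U : (Q x : Word) → x ++ g ≡ Q → ¬ FactorOf f Q → (M : ℕ) →
    FactorOf f (Q ++ 1 ∷ c ∷ replicate M 0) → InU q f
  block-extension⇒U Q x xg≡Q ¬occ M (u , v , e) with ++-split u (f ++ v) Q (1 ∷ c ∷ replicate M 0) (sym e)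
  ... | inj₁ (s , _ , blk≡) = inside-block⇒U s v M blk≡
  ... | inj₂ (s , Q≡us , fv≡) with ++-split f v s (1 ∷ c ∷ replicate M 0) fv≡
  ...   | inj₂ (s′ , s≡fs′ , _) = ⊥-elim (¬occ (u , s′ , trans Q≡us (cong (u ++_) s≡fs′)))
  ...   | inj₁ ([] , f≡s , _) = ⊥-elim (¬occ (u , [] , trans Q≡us (cong (u ++_)
            (trans (sym (++-identityʳ s)) (trans (sym f≡s) (sym (++-identityʳ f)))))))
  ...   | inj₁ (z ∷ s′ , f≡ , blk≡) = straddle⇒U x u s z s′ v M (trans xg≡Q Q≡us) f≡ blk≡

  -- f is not a block of zeros (0^(L+1) is a suffix of 1 (q-1) 0^L), so its
  -- trailing zeros are preceded by a nonzero symbol.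
  all-zeros⇒U : (L : ℕ) → f ≡ replicate L 0 → InU q f
  all-zeros⇒U zero e = empty g (trans (sym f≡g0) e)
    where
    empty : (g : Word) → g ++ 0 ∷ [] ≡ [] → InU q f
    empty []      ()
    empty (_ ∷ _) ()
  all-zeros⇒U (suc L) e = power-suffix⇒U L 1 (1 ∷ c ∷ [])
    (trans (cong (λ z → 1 ∷ c ∷ z) g≡0^L) (sym (++-identityʳ (block q L))))
    where
    g≡0^L : g ≡ replicate L 0
    g≡0^L = proj₁ (∷ʳ-injective g (replicate L 0) (trans (sym f≡g0) (trans e (replicate-snoc L 0))))

  trailing-decomposition : ∃ λ y → ∃ λ s → (y ≢ 0) × reverse f ≡ replicate ℓ 0 ++ y ∷ s
  trailing-decomposition with leading-zeros-decomposition (reverse f)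
  ... | inj₂ d = d
  ... | inj₁ e = ⊥-elim (f∉U (all-zeros⇒U ℓ
          (trans (sym (reverse-involutive f)) (trans (cong reverse e) (reverse-replicate ℓ 0)))))

  -- W's symbol at k is extremal in the local order at k, relative to a
  -- reference parity S: 0 where the prefix sum has the parity of S, q-1 where
  -- prefix sum plus q-1 has it, or 1 (prefix sum of parity S) where the
  -- competitor a does not put 0.  For S even this makes W k locally least,
  -- for S odd locally greatest.
  data Optimal (a W : InfWord) (S k : ℕ) : Set where
    is-0 : W k ≡ 0 → SameParity (sumTo W k) S → Optimal a W S k
    is-c : W k ≡ c → SameParity (sumTo W k + c) S → Optimal a W S k
    is-1 : W k ≡ 1 → SameParity (sumTo W k) S → a k ≢ 0 → Optimal a W S k

  optimal-0 : ∀ {a W S k} t → W k ≡ 0 → sumTo W k ≡ S + t → Even t → Optimal a W S k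
  optimal-0 {S = S} t W≡0 sum≡ even-t = is-0 W≡0 (trans (cong (_% 2) sum≡) (+-even S even-t))

  optimal-c : ∀ {a W S k} t → W k ≡ c → sumTo W k ≡ S + t → Odd t → Optimal a W S k
  optimal-c {S = S} t W≡c sum≡ odd-t = is-c W≡c
    (trans (cong (λ n → (n + c) % 2) sum≡) (trans (cong (_% 2) (+-assoc S t c)) (+-even S (odd+odd {t} {c} odd-t odd-c))))

  optimal-1 : ∀ {a W S k} t → W k ≡ 1 → sumTo W k ≡ S + t → Even t → a k ≢ 0 → Optimal a W S k
  optimal-1 {S = S} t W≡1 sum≡ even-t a≢0 = is-1 W≡1 (trans (cong (_% 2) sum≡) (+-even S even-t)) a≢0

  optimal-least : ∀ {a W S k} → Even S → a k < q → Optimal a W S k → ¬ Precedes (sumTo W k) (a k) (W k)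
  optimal-least {a} {W} {S} {k} eS a<q = least
    where
    least : Optimal a W S k → ¬ Precedes (sumTo W k) (a k) (W k)
    least (is-0 W≡0 _)       (inj₁ (_ , a<W)) = n≮0 (subst (a k <_) W≡0 a<W)
    least (is-0 _ same)      (inj₂ (odd , _)) = even⇒¬odd {sumTo W k} (trans same eS) odd
    least (is-c _ same)      (inj₁ (even , _)) =
      even⇒¬odd {sumTo W k + c} (trans same eS) (even+odd {sumTo W k} {c} even odd-c)
    least (is-c W≡c _)       (inj₂ (_ , W<a)) = c-maximal (subst (_< a k) W≡c W<a) a<q
    least (is-1 W≡1 _ a≢0)   (inj₁ (_ , a<W)) = a≢0 (n<1⇒n≡0 (subst (a k <_) W≡1 a<W))
    least (is-1 _ same _)    (inj₂ (odd , _)) = even⇒¬odd {sumTo W k} (trans same eS) odd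

  optimal-greatest : ∀ {a W S k} → Odd S → a k < q → Optimal a W S k → ¬ Precedes (sumTo W k) (W k) (a k)
  optimal-greatest {a} {W} {S} {k} oS a<q = greatest
    where
    greatest : Optimal a W S k → ¬ Precedes (sumTo W k) (W k) (a k)
    greatest (is-0 _ same)      (inj₁ (even , _)) = even⇒¬odd {sumTo W k} even (trans same oS)
    greatest (is-0 W≡0 _)       (inj₂ (_ , a<W)) = n≮0 (subst (a k <_) W≡0 a<W)
    greatest (is-c W≡c _)       (inj₁ (_ , W<a)) = c-maximal (subst (_< a k) W≡c W<a) a<q
    greatest (is-c _ same)      (inj₂ (odd , _)) =
      even⇒¬odd {sumTo W k + c} (odd+odd {sumTo W k} {c} odd odd-c) (trans same oS)
    greatest (is-1 _ same _)    (inj₁ (even , _)) = even⇒¬odd {sumTo W k} even (trans same oS)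
    greatest (is-1 W≡1 _ a≢0)   (inj₂ (_ , a<W)) = a≢0 (n<1⇒n≡0 (subst (a k <_) W≡1 a<W))

  Extremal : Word → InfWord → ℕ → Set
  Extremal P W S = ∀ a → PrefixOf P a → ¬ InfFactorOf f a →
    ∀ m → Agree a W (length P + m) → Optimal a W S (length P + m)

  extremal-at : ∀ {P W S a} → Extremal P W S → PrefixOf P a → ¬ InfFactorOf f a →
    ∀ k → length P ≤ k → Agree a W k → Optimal a W S k
  extremal-at {P} {W} {S} {a} ext pa a-avoids k P≤k =
    subst (λ k → Agree a W k → Optimal a W S k) (m+[n∸m]≡n P≤k) (ext a pa a-avoids (k ∸ length P))

  extremal-first : ∀ {p W S a} → Even S → Extremal p W S → PrefixOf p W → InCyl q f p a → a ≼ W → a ≐ W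
  extremal-first eS ext pW a-in (inj₂ a≐W) = a≐W
  extremal-first {p} {W} {S} {a} eS ext pW (a-word , pa , a-avoids) (inj₁ (k , agree , prec)) with k <? length p
  ... | yes k<p = ⊥-elim (precedes-irrefl {sumTo a k} (prefix-at p {a} {W} pa pW k<p) prec)
  ... | no  k≮p = ⊥-elim (optimal-least eS (a-word k) (extremal-at {p} {W} {S} {a} ext pa a-avoids k (≮⇒≥ k≮p) agree)
                    (subst (λ e → Precedes e (a k) (W k)) (sumTo-cong a W k agree) prec))

  extremal-last : ∀ {p W S a} → Odd S → Extremal p W S → PrefixOf p W → InCyl q f p a → W ≼ a → a ≐ W
  extremal-last oS ext pW a-in (inj₂ W≐a) n = sym (W≐a n)
  extremal-last {p} {W} {S} {a} oS ext pW (a-word , pa , a-avoids) (inj₁ (k , agree , prec)) with k <? length p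
  ... | yes k<p = ⊥-elim (precedes-irrefl {sumTo W k} (prefix-at p {W} {a} pW pa k<p) prec)
  ... | no  k≮p = ⊥-elim (optimal-greatest oS (a-word k)
                    (extremal-at {p} {W} {S} {a} ext pa a-avoids k (≮⇒≥ k≮p) (λ t t<k → sym (agree t t<k))) prec)

  extremal-snoc-c : (p : Word) {W : InfWord} → PrefixOf (p ++ c ∷ []) W →
    Extremal (p ++ c ∷ []) W (sum p + c) → Extremal p W (sum p + c)
  extremal-snoc-c p {W} pW ext a pa a-avoids zero agree =
    subst (Optimal a W (sum p + c)) (sym (+-identityʳ (length p)))
      (is-c (snoc-at p {W} {c} pW) (cong (λ n → (n + c) % 2) (sumTo-prefix p (prefix-take p {c ∷ []} {W} pW))))
  extremal-snoc-c p {W} pW ext a pa a-avoids (suc m) agree =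
    subst (Optimal a W (sum p + c)) (length-snoc-+ p c m)
      (ext a pa′ a-avoids m (subst (Agree a W) (sym (length-snoc-+ p c m)) agree))
    where
    pa′ : PrefixOf (p ++ c ∷ []) a
    pa′ = prefix-snoc p {a} {c} pa (trans (agree (length p) (m<m+n (length p) (s≤s z≤n))) (snoc-at p {W} {c} pW))

  EndsNonzero : Word → Set
  EndsNonzero P = ∃ λ Q → ∃ λ z → P ≡ Q ++ z ∷ [] × z ≢ 0

  record GreedyTail (P : Word) : Set where
    field
      r        : Word
      r-word   : IsWord q r
      avoids   : ¬ InfFactorOf f (P ⊕ (r ⊕ zeros))
      shape    : Shape1 q ℓ r
      tight    : EndsNonzero P → r ≡ [] ⊎ r ≡ replicate (ℓ ∸ 1) 0 ++ 1 ∷ c ∷ []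
      extremal : Extremal P (P ⊕ (r ⊕ zeros)) (sum P)

  suffix-zeros-bounds : (P x : Word) (j : ℕ) → x ++ f ≡ P ++ replicate j 0 → j ≤ ℓ × (EndsNonzero P → ℓ ≤ j)
  suffix-zeros-bounds P x j xf≡ with trailing-decomposition
  ... | y , s , y≢0 , rev-f = leading-zeros-bound ℓ j y (s ++ reverse x) (reverse P) y≢0 reversed , ends
    where
    open ≡-Reasoning
    reversed : replicate ℓ 0 ++ y ∷ (s ++ reverse x) ≡ replicate j 0 ++ reverse P
    reversed = begin
      replicate ℓ 0 ++ y ∷ (s ++ reverse x)  ≡⟨ ++-assoc (replicate ℓ 0) (y ∷ s) (reverse x) ⟨
      (replicate ℓ 0 ++ y ∷ s) ++ reverse x  ≡⟨ cong (_++ reverse x) rev-f ⟨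
      reverse f ++ reverse x                 ≡⟨ reverse-++ x f ⟨
      reverse (x ++ f)                       ≡⟨ cong reverse xf≡ ⟩
      reverse (P ++ replicate j 0)           ≡⟨ reverse-++ P (replicate j 0) ⟩
      reverse (replicate j 0) ++ reverse P   ≡⟨ cong (_++ reverse P) (reverse-replicate j 0) ⟩
      replicate j 0 ++ reverse P             ∎
    ends : EndsNonzero P → ℓ ≤ j
    ends (Q , z , P≡Qz , z≢0) = leading-zeros-bound j ℓ z (reverse Q) (y ∷ s ++ reverse x) z≢0
      (sym (trans reversed (cong (replicate j 0 ++_) (trans (cong reverse P≡Qz) (reverse-++ Q (z ∷ []))))))

  -- r = ε: P 0^∞ is extremal, as 0 is optimal at every position.
  zeros-extremal : (P : Word) → Extremal P (P ⊕ zeros) (sum P)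
  zeros-extremal P a pa a-avoids m agree =
    optimal-0 0 (⊕-shift P zeros m) (trans (sumTo-⊕ P zeros m) (cong (sum P +_) (sumTo-zeros m))) refl

  module BlockTail (P : Word) (i : ℕ) (occ : FactorOf f (P ++ replicate (suc i) 0))
                   (¬occ : ¬ FactorOf f (P ++ replicate i 0)) where

    R : Word
    R = replicate i 0 ++ 1 ∷ c ∷ []

    R-word : (i : ℕ) → IsWord q (replicate i 0 ++ 1 ∷ c ∷ [])
    R-word zero    = 2≤q ∷ c<q ∷ []
    R-word (suc i) = 0<q ∷ R-word i

    Q : Word
    Q = P ++ replicate i 0

    W : InfWord
    W = P ⊕ (R ⊕ zeros)

    Q0≡ : Q ++ 0 ∷ [] ≡ P ++ replicate (suc i) 0
    Q0≡ = trans (++-assoc P (replicate i 0) (0 ∷ [])) (cong (P ++_) (sym (replicate-snoc i 0)))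

    occ-Q0 : FactorOf f (Q ++ 0 ∷ [])
    occ-Q0 = subst (FactorOf f) (sym Q0≡) occ

    f-suffix : ∃ λ x → x ++ f ≡ Q ++ 0 ∷ []
    f-suffix = new-occurrence-is-suffix f Q 0 ¬occ occ-Q0

    x : Word
    x = proj₁ f-suffix

    xg≡Q : x ++ g ≡ Q
    xg≡Q = proj₁ (∷ʳ-injective (x ++ g) Q
      (trans (++-assoc x g (0 ∷ [])) (trans (cong (x ++_) (sym f≡g0)) (proj₂ f-suffix))))

    W≐ : W ≐ ((Q ++ 1 ∷ c ∷ []) ⊕ zeros)
    W≐ n = trans (sym (⊕-++ P R zeros n))
      (cong (λ w → (w ⊕ zeros) n) (sym (++-assoc P (replicate i 0) (1 ∷ c ∷ []))))

    avoids : ¬ InfFactorOf f W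
    avoids occ∞ = f∉U (block-extension⇒U Q x xg≡Q ¬occ (length f)
      (subst (FactorOf f) (++-assoc Q (1 ∷ c ∷ []) (replicate (length f) 0))
        (zeros-occurrence f (Q ++ 1 ∷ c ∷ []) (occurrence-≐ {f} {W} W≐ occ∞))))


    bounds : suc i ≤ ℓ × (EndsNonzero P → ℓ ≤ suc i)
    bounds = suffix-zeros-bounds P x (suc i) (trans (proj₂ f-suffix) Q0≡)

    i<ℓ : i < ℓ
    i<ℓ = proj₁ bounds

    tight : EndsNonzero P → R ≡ [] ⊎ R ≡ replicate (ℓ ∸ 1) 0 ++ 1 ∷ c ∷ []
    tight ends = inj₂ (cong (λ n → replicate n 0 ++ 1 ∷ c ∷ []) (sym (cong (_∸ 1) (≤-antisym (proj₂ bounds ends) i<ℓ))))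

    -- Past P, W reads 0^i 1 (q-1) 0^∞ = 0^i Y with prefix sums sum P + 0, 1, q, q, …
    Y : InfWord
    Y = (1 ∷ c ∷ []) ⊕ zeros

    Y-sum : (n : ℕ) → sumTo Y (suc (suc n)) ≡ q
    Y-sum n = trans (sumTo-⊕ (1 ∷ c ∷ []) zeros n)
      (trans (cong₂ _+_ (cong suc (+-identityʳ c)) (sumTo-zeros n)) (trans (+-identityʳ (suc c)) suc-c))

    tail≐ : (R ⊕ zeros) ≐ (replicate i 0 ⊕ Y)
    tail≐ = ⊕-++ (replicate i 0) (1 ∷ c ∷ []) zeros

    symbol-after : (m : ℕ) → W (length P + m) ≡ (replicate i 0 ⊕ Y) m
    symbol-after m = trans (⊕-shift P (R ⊕ zeros) m) (tail≐ m)

    sum-after : (m : ℕ) → sumTo W (length P + m) ≡ sum P + sumTo (replicate i 0 ⊕ Y) m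
    sum-after m = trans (sumTo-⊕ P (R ⊕ zeros) m) (cong (sum P +_) (sumTo-cong _ _ m (λ t _ → tail≐ t)))

    symbol-after-zeros : (n : ℕ) → W (length P + (i + n)) ≡ Y n
    symbol-after-zeros n = trans (symbol-after (i + n)) (zeros-⊕-high i n Y)

    sum-after-zeros : (n : ℕ) → sumTo W (length P + (i + n)) ≡ sum P + sumTo Y n
    sum-after-zeros n = trans (sum-after (i + n)) (cong (sum P +_) (sumTo-zeros-⊕-high i n Y))

    Q-prefix : PrefixOf Q W
    Q-prefix = prefix-≐ {Q} (λ n → sym (W≐ n)) (prefix-take Q {1 ∷ c ∷ []} {(Q ++ 1 ∷ c ∷ []) ⊕ zeros} (prefix-⊕ (Q ++ 1 ∷ c ∷ []) zeros))

    -- Positions from the symbol 1 on; at the 1 itself, a competitor agreeing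
    -- with W so far has prefix Q and cannot continue with 0, as Q 0 contains f.
    extremal-after-zeros : ∀ a → PrefixOf P a → ¬ InfFactorOf f a →
      ∀ n → Agree a W (length P + (i + n)) → Optimal a W (sum P) (length P + (i + n))
    extremal-after-zeros a pa a-avoids zero agree =
      optimal-1 0 (symbol-after-zeros 0) (sum-after-zeros 0) refl a≢0
      where
      at-Q : length P + (i + 0) ≡ length Q
      at-Q = trans (cong (length P +_) (+-identityʳ i)) (sym (trans (length-++ P) (cong (length P +_) (length-replicate i))))
      a≢0 : a (length P + (i + 0)) ≢ 0
      a≢0 a≡0 = a-avoids (factor⇒occurrence {f} {Q ++ 0 ∷ []} {a} occ-Q0 (prefix-snoc Q {a} {0}
        (prefix-agree Q {a} {W} Q-prefix (λ t t<Q → agree t (subst (t <_) (sym at-Q) t<Q))) (trans (cong a (sym at-Q)) a≡0)))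
    extremal-after-zeros a pa a-avoids (suc zero) agree =
      optimal-c 1 (symbol-after-zeros 1) (sum-after-zeros 1) refl
    extremal-after-zeros a pa a-avoids (suc (suc n)) agree =
      optimal-0 q (symbol-after-zeros (suc (suc n))) (trans (sum-after-zeros (suc (suc n))) (cong (sum P +_) (Y-sum n))) q-even

    extremal : Extremal P W (sum P)
    extremal a pa a-avoids m agree with m <? i
    ... | yes m<i = optimal-0 0 (trans (symbol-after m) (zeros-⊕-low i m Y m<i))
                      (trans (sum-after m) (cong (sum P +_) (sumTo-zeros-⊕-low i m Y (<⇒≤ m<i)))) refl
    ... | no  m≮i = subst (λ m → Agree a W (length P + m) → Optimal a W (sum P) (length P + m))
                      (m+[n∸m]≡n (≮⇒≥ m≮i)) (extremal-after-zeros a pa a-avoids (m ∸ i)) agree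

  greedy-tail : (P : Word) → ¬ FactorOf f P → GreedyTail P
  greedy-tail P ¬occ with factor? f (P ++ replicate (length f) 0)
  ... | no ¬occ₀ = record
    { r = [] ; r-word = [] ; avoids = λ occ∞ → ¬occ₀ (zeros-occurrence f P occ∞)
    ; shape = inj₁ refl ; tight = λ _ → inj₁ refl ; extremal = zeros-extremal P }
  ... | yes occ₀ with first-zero-occurrence f P (length f) occ₀ ¬occ
  ... | i , occ , ¬occ′ = record
    { r = R ; r-word = R-word i ; avoids = avoids
    ; shape = inj₂ (i , i<ℓ , refl) ; tight = tight ; extremal = extremal }
    where open BlockTail P i occ ¬occ′

  -- Since f ends in 0, appending the nonzero symbol q-1 creates no occurrence.
  snoc-c-avoids : (p : Word) → ¬ FactorOf f p → ¬ FactorOf f (p ++ c ∷ [])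
  snoc-c-avoids p ¬occ occ with new-occurrence-is-suffix f p c ¬occ occ
  ... | u , uf≡ = c≢0 (sym (proj₂ (∷ʳ-injective (u ++ g) p
          (trans (++-assoc u g (0 ∷ [])) (trans (cong (u ++_) (sym f≡g0)) uf≡)))))

  record Candidate (Shape : ℕ → ℕ → Word → Set) (p : Word) (S : ℕ) : Set where
    field
      r        : Word
      shape    : Shape q ℓ r
      word     : InfWord
      word≐    : word ≐ (p ⊕ (r ⊕ zeros))
      in-cyl   : InCyl q f p word
      extremal : Extremal p word S

  shape1-candidate : (p : Word) → IsWord q p → ¬ FactorOf f p → Candidate Shape1 p (sum p)
  shape1-candidate p p-word ¬occ = record
    { r = r ; shape = shape ; word = p ⊕ (r ⊕ zeros) ; word≐ = λ _ → refl
    ; in-cyl = ⊕-word q p _ p-word (⊕-word q r zeros r-word (λ _ → 0<q)) , prefix-⊕ p _ , avoids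
    ; extremal = extremal }
    where open GreedyTail (greedy-tail p ¬occ)

  -- Case (2): q-1 followed by the greedy continuation of p(q-1), which ends in
  -- a nonzero symbol, so that continuation is ε or 0^(ℓ-1) 1 (q-1).
  shape2-candidate : (p : Word) → IsWord q p → ¬ FactorOf f p → Candidate Shape2 p (sum p + c)
  shape2-candidate p p-word ¬occ = record
    { r = c ∷ r ; shape = shape2 (tight (p , c , refl , c≢0)) ; word = W ; word≐ = W≐
    ; in-cyl = ⊕-word q P _ (word-snoc q p c p-word c<q) (⊕-word q r zeros r-word (λ _ → 0<q))
             , prefix-take p {c ∷ []} {W} (prefix-⊕ P _) , avoids
    ; extremal = extremal-snoc-c p {W} (prefix-⊕ P _) (subst (Extremal P W) (sum-snoc p c) extremal) }
    where
    P : Word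
    P = p ++ c ∷ []
    open GreedyTail (greedy-tail P (snoc-c-avoids p ¬occ))
    W : InfWord
    W = P ⊕ (r ⊕ zeros)
    W≐ : W ≐ (p ⊕ ((c ∷ r) ⊕ zeros))
    W≐ n = trans (⊕-++ p (c ∷ []) (r ⊕ zeros) n) (⊕-cong p (λ { zero → refl ; (suc m) → refl }) n)
    shape2 : r ≡ [] ⊎ r ≡ replicate (ℓ ∸ 1) 0 ++ 1 ∷ c ∷ [] → Shape2 q ℓ (c ∷ r)
    shape2 (inj₁ r≡) = inj₁ (cong (c ∷_) r≡)
    shape2 (inj₂ r≡) = inj₂ (cong (c ∷_) r≡)

  from-first : ∀ {Shape p S a} → Candidate Shape p S → Even S → IsFirst q f p a →
    ∃ λ r → Shape q ℓ r × a ≐ (p ⊕ (r ⊕ zeros))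
  from-first {p = p} C even-S (a-in , first) =
    r , shape , λ n → trans (extremal-first {p} even-S extremal (proj₁ (proj₂ in-cyl)) a-in (first word in-cyl) n) (word≐ n)
    where open Candidate C

  from-last : ∀ {Shape p S a} → Candidate Shape p S → Odd S → IsLast q f p a →
    ∃ λ r → Shape q ℓ r × a ≐ (p ⊕ (r ⊕ zeros))
  from-last {p = p} C odd-S (a-in , last) =
    r , shape , λ n → trans (extremal-last {p} odd-S extremal (proj₁ (proj₂ in-cyl)) a-in (last word in-cyl) n) (word≐ n)
    where open Candidate C

proposition7 : (q : ℕ) → Even q → 2 ≤ q →
    (f : Word) → IsWord q f → ¬ InU q f → (∃ λ g → f ≡ g ++ 0 ∷ []) →
    (p : Word) → IsWord q p → ¬ FactorOf f p →
    (a : InfWord) →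
    ((IsFirst q f p a → EvenWord p → ∃ λ r → Shape1 q (trailingZeros f) r × a ≐ (p ⊕ (r ⊕ zeros)))
    × (IsLast q f p a → OddWord p → ∃ λ r → Shape1 q (trailingZeros f) r × a ≐ (p ⊕ (r ⊕ zeros)))
    × (IsFirst q f p a → OddWord p → ∃ λ r → Shape2 q (trailingZeros f) r × a ≐ (p ⊕ (r ⊕ zeros)))
    × (IsLast q f p a → EvenWord p → ∃ λ r → Shape2 q (trailingZeros f) r × a ≐ (p ⊕ (r ⊕ zeros))))
proposition7 q q-even 2≤q f _ f∉U (g , f≡g0) p p-word ¬occ a =
    (λ first even-p → from-first case1 even-p first)
  , (λ last odd-p → from-last case1 odd-p last)
  , (λ first odd-p → from-first case2 (odd+odd {sum p} {c} odd-p odd-c) first)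
  , (λ last even-p → from-last case2 (even+odd {sum p} {c} even-p odd-c) last)
  where
  open GreedyContinuation q q-even 2≤q f g f≡g0 f∉U
  case1 : Candidate Shape1 p (sum p)
  case1 = shape1-candidate p p-word ¬occ
  case2 : Candidate Shape2 p (sum p + c)
  case2 = shape2-candidate p p-word ¬occ
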